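{- Let $\mathbf{O}$ be an appropriate class of operators, $k\in\mathbb{N}$, and $f:\mathbb{N}\to\mathbb{N}$ a unary $\mathbf{O}$-representable function. Then the $k$-ary operator $F$ defined by $F(f_1,\ldots,f_k)=f$ belongs to $\mathbf{O}$.
   Context: $\mathbb{T}_1$ is the set of total functions $\mathbb{N}\to\mathbb{N}$; a $k$-ary operator is a map $\mathbb{T}_1^k\to\mathbb{T}_1$; $\check{c}\in\mathbb{T}_1$ is the constant function with value $c$. A class $\mathbf{O}$ of operators is appropriate if: (1) for all $k$ and $i\le k$ the operator $(f_1,\ldots,f_k)\mapsto f_i$ is in $\mathbf{O}$; (2) the operator $F(f_1,f_2)(n)=f_1(f_2(n))$ is in $\mathbf{O}$; (3) if $F$ is $k$-ary in $\mathbf{O}$ and $G_1,\ldots,G_k$ are $l$-ary in $\mathbf{O}$, then $H(g_1,\ldots,g_l)=F(G_1(g_1,\ldots,g_l),\ldots,G_k(g_1,\ldots,g_l))$ is in $\mathbf{O}$; (4) if $F$ is $(k+1)$-ary in $\mathbf{O}$, then $G(f_1,\ldots,f_k)(n)=F(f_1,\ldots,f_k,\check{n})(n)$ is in $\mathbf{O}$. For $f:\mathbb{N}^r\to\mathbb{N}$, $\mathring{f}$ is the $r$-ary operator $\mathring{f}(f_1,\ldots,f_r)(n)=f(f_1(n),\ldots,f_r(n))$; $f$ is $\mathbf{O}$-representable if $\mathring{f}\in\mathbf{O}$. -}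

module Defs where

open import Data.Nat using (ℕ)
open import Data.Fin using (Fin; zero; suc)

𝕋₁ : Set
𝕋₁ = ℕ → ℕ

-- a k-ary operator: a map 𝕋₁^k → 𝕋₁ (tuples as functions Fin k → 𝕋₁)
Op : ℕ → Set
Op k = (Fin k → 𝕋₁) → 𝕋₁

OpClass : Set₁
OpClass = (k : ℕ) → Op k → Set

consť : ℕ → 𝕋₁
consť c = λ _ → c

-- extend a k-tuple by one more entry at the end: (f₁,…,f_k,g)
-- (entry i < k is fs i, entry k is g)
snoc : ∀ {k} → (Fin k → 𝕋₁) → 𝕋₁ → Fin (Data.Nat.suc k) → 𝕋₁
snoc {Data.Nat.zero} fs g zero = g
snoc {Data.Nat.suc k} fs g zero = fs zero
snoc {Data.Nat.suc k} fs g (suc i) = snoc (λ j → fs (suc j)) g i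

record Appropriate (O : OpClass) : Set where
  field
    proj-mem : (k : ℕ) (i : Fin k) → O k (λ fs → fs i)
    comp-mem : O 2 (λ fs n → fs zero (fs (suc zero) n))
    -- (3) closure under substitution
    subst-mem : (k l : ℕ) (F : Op k) (G : Fin k → Op l) →
                O k F → ((i : Fin k) → O l (G i)) →
                O l (λ gs → F (λ i → G i gs))
    -- (4) diagonalisation G(f₁,…,f_k)(n) = F(f₁,…,f_k,ň)(n)
    diag-mem : (k : ℕ) (F : Op (Data.Nat.suc k)) →
               O (Data.Nat.suc k) F →
               O k (λ fs n → F (snoc fs (consť n)) n)

-- f̊ for unary f : f̊(f₁)(n) = f(f₁(n))
ring₁ : (ℕ → ℕ) → Op 1
ring₁ f = λ fs n → f (fs zero n)

Representable₁ : OpClass → (ℕ → ℕ) → Set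
Representable₁ O f = O 1 (ring₁ f)

module Submission where

-- Write ι for the identity function on ℕ.  By axiom (4)
-- applied to the unary projection, the nullary operator with value ι lies in
-- O: diagonalising f₁ ↦ f₁ gives n ↦ č n (n) = n.  Substituting this nullary
-- operator into nothing (axiom (3) with k = 0) gives, for every arity l, the
-- l-ary operator with constant value ι.  Finally, the k-ary operator with
-- constant value f is obtained from f̊ by substituting the constant-ι operator
-- for its single argument, since f̊(ι) = f ∘ ι = f.

open import Defs
open import Data.Nat using (ℕ)
open import Data.Fin using (zero)

module _ {O : OpClass} (appropriate : Appropriate O) where

  open Appropriate appropriate

  weaken-nullary : (l : ℕ) (F : Op 0) → O 0 F → O l (λ _ → F (λ ()))
  weaken-nullary l F F∈O = subst-mem 0 l F (λ ()) F∈O (λ ())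

  -- The nullary operator whose value is the identity function on ℕ:
  -- diagonalising the unary projection gives n ↦ č n (n) = n.
  identity-nullary : O 0 (λ _ n → n)
  identity-nullary = diag-mem 0 (λ fs → fs zero) (proj-mem 1 zero)

  identity-const : (l : ℕ) → O l (λ _ n → n)
  identity-const l = weaken-nullary l (λ _ n → n) identity-nullary

corollary2 : (O : OpClass) → Appropriate O → (k : ℕ) (f : ℕ → ℕ) →
             Representable₁ O f → O k (λ _ → f)
corollary2 O appropriate k f f-rep =
  -- f̊ (ι) = f, with the constant-ι operator substituted for the argument of f̊.
  Appropriate.subst-mem appropriate 1 k (ring₁ f) (λ _ _ n → n)
    f-rep (λ _ → identity-const appropriate k)
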